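{- Let $W_{\Delta,n}$ be a Knödel graph and $s=2^{\Delta-1}-1$. If $(k-1)s<i\le\lfloor n/4\rfloor$ for some positive integer $k$, then $d(u_0,u_i)\ge 2k$.
   Context: Knödel graph: for an even integer $n$ and an integer $\Delta$ with $1\le\Delta\le\lfloor\log_2 n\rfloor$, $W_{\Delta,n}$ is the simple bipartite graph with vertex set $U\cup V$, $U=\{u_0,\dots,u_{n/2-1}\}$, $V=\{v_0,\dots,v_{n/2-1}\}$; indices are read modulo $n/2$. The vertices $u_i$ and $v_j$ are adjacent iff $j-i\equiv 2^k-1\pmod{n/2}$ for some $k\in\{0,\dots,\Delta-1\}$; no other edges. $d(x,y)$ is the graph distance (taken to be $\infty$ if there is no path). -}

module Defs where

open import Data.Nat using (ℕ; zero; suc; _+_; _*_; _∸_; _^_; _≤_; _<_; NonZero)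
open import Data.Nat.DivMod using (_%_)
open import Data.Fin using (Fin; toℕ)
open import Data.Bool using (Bool; true; false)
open import Data.Product using (Σ; _×_; _,_; ∃-syntax)
open import Relation.Binary.PropositionalEquality using (_≡_)

-- Knödel graph W_{Δ,n} with n = 2 * m, m = n/2 (m ≥ 1).
-- Vertex (false , i) is u_i, vertex (true , j) is v_j, for i j : Fin m.
Vertex : ℕ → Set
Vertex m = Bool × Fin m

u : ∀ {m} → Fin m → Vertex m
u i = false , i

v : ∀ {m} → Fin m → Vertex m
v j = true , j

UVAdj : (m Δ : ℕ) → .{{_ : NonZero m}} → Fin m → Fin m → Set
UVAdj m Δ i j = ∃[ k ] (k < Δ × toℕ j ≡ (toℕ i + (2 ^ k ∸ 1)) % m)

Adj : (m Δ : ℕ) → .{{_ : NonZero m}} → Vertex m → Vertex m → Set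
Adj m Δ (false , i) (true , j) = UVAdj m Δ i j
Adj m Δ (true , j) (false , i) = UVAdj m Δ i j
Adj m Δ (false , _) (false , _) = Data.Empty.⊥
  where import Data.Empty
Adj m Δ (true , _) (true , _) = Data.Empty.⊥
  where import Data.Empty

data Walk (m Δ : ℕ) .{{_ : NonZero m}} : Vertex m → Vertex m → ℕ → Set where
  []  : ∀ {x} → Walk m Δ x x zero
  _∷_ : ∀ {x y z ℓ} → Adj m Δ x y → Walk m Δ y z ℓ → Walk m Δ x z (suc ℓ)

-- d(x,y) ≥ D  (with d = ∞ when no path exists): every walk (hence every
-- path, in particular a shortest one) from x to y has length ≥ D.
DistGE : (m Δ : ℕ) → .{{_ : NonZero m}} → Vertex m → Vertex m → ℕ → Set
DistGE m Δ x y D = ∀ ℓ → Walk m Δ x y ℓ → D ≤ ℓ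

module Submission where

-- Put s = 2^(Δ-1) - 1.  Every edge of W_{Δ,n} joins
-- u_i to v_j with j ≡ i + o (mod m), m = n/2, for an offset o = 2^k - 1 ≤ s.
-- Along a walk, a step u → v moves the index forward by such an offset and
-- a step v → u moves it backward by one.  So a walk from x to z with a
-- forward and c backward steps satisfies
--     index z + N ≡ index x + P  (mod m),   P ≤ a·s,  N ≤ c·s,
-- where P and N are the total forward and backward offsets; moreover the
-- graph is bipartite, so a walk between two U-vertices has a = c and length 2a.  For a walk u_0 → u_i with a < k steps in
-- each direction we get P, N ≤ (k-1)s < i, while i ≤ ⌊n/4⌋ gives 2i ≤ m;
-- hence such a walk is impossible ('return-walk-long'), i.e. every walk
-- has length 2a ≥ 2k, which is the theorem.

open import Defs
open import Data.Nat using (ℕ; suc; _+_; _*_; _∸_; _^_; _≤_; _<_; _/_; _≤?_; NonZero; z≤n)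
open import Data.Nat.Properties
open import Data.Nat.DivMod using (_%_; %-distribˡ-+; m%n%n≡m%n; m<n⇒m%n≡m; m/n*n≤m)
open import Data.Nat.Logarithm using (⌊log₂_⌋)
open import Data.Fin using (Fin; toℕ; zero)
open import Data.Bool using (false; true)
open import Data.Product using (_,_)
open import Relation.Nullary using (¬_; yes; no; contradiction)
open import Relation.Binary.PropositionalEquality

side : ∀ {m} → Vertex m → ℕ
side (false , _) = 0
side (true , _) = 1

index : ∀ {m} → Vertex m → ℕ
index (_ , i) = toℕ i

maxOffset : ℕ → ℕ
maxOffset Δ = 2 ^ (Δ ∸ 1) ∸ 1

offset≤maxOffset : ∀ {k Δ} → k < Δ → 2 ^ k ∸ 1 ≤ maxOffset Δ
offset≤maxOffset k<Δ = ∸-monoˡ-≤ 1 (^-monoʳ-≤ 2 (<⇒≤pred k<Δ))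

module _ {m : ℕ} .{{_ : NonZero m}} where

  %-cong-+ʳ : ∀ a b c → a % m ≡ b % m → (a + c) % m ≡ (b + c) % m
  %-cong-+ʳ a b c a≡b = begin
    (a + c) % m             ≡⟨ %-distribˡ-+ a c m ⟩
    (a % m + c % m) % m     ≡⟨ cong (λ t → (t + c % m) % m) a≡b ⟩
    (b % m + c % m) % m     ≡⟨ %-distribˡ-+ b c m ⟨
    (b + c) % m             ∎
    where open ≡-Reasoning

  %-absorbˡ : ∀ a b → (a % m + b) % m ≡ (a + b) % m
  %-absorbˡ a b = %-cong-+ʳ (a % m) a b (m%n%n≡m%n a m)

  -- If 0 ≤ P, N < i and 2i ≤ m then i + N ≢ P (mod m): both sides are
  -- already reduced, and i + N ≥ i > P.
  no-wraparound : ∀ {i P N} → P < i → N < i → 2 * i ≤ m → ¬ ((i + N) % m ≡ P % m)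
  no-wraparound {i} {P} {N} P<i N<i 2i≤m i+N≡P =
    <-irrefl refl (<-≤-trans P<i (≤-trans (m≤m+n i N) (≤-reflexive i+N≡P′)))
    where
    i+i≤m : i + i ≤ m
    i+i≤m = subst (_≤ m) (cong (i +_) (+-identityʳ i)) 2i≤m
    i+N≡P′ : i + N ≡ P
    i+N≡P′ = begin
      i + N         ≡⟨ m<n⇒m%n≡m (<-≤-trans (+-monoʳ-< i N<i) i+i≤m) ⟨
      (i + N) % m   ≡⟨ i+N≡P ⟩
      P % m         ≡⟨ m<n⇒m%n≡m (<-≤-trans P<i (≤-trans (m≤m+n i i) i+i≤m)) ⟩
      P             ∎
      where open ≡-Reasoning

module _ (m Δ : ℕ) .{{_ : NonZero m}} where

  private
    s : ℕ
    s = maxOffset Δ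

  record Summary (x z : Vertex m) (ℓ : ℕ) : Set where
    field
      forwards backwards ahead behind : ℕ
      ahead-bound : ahead ≤ forwards * s
      behind-bound : behind ≤ backwards * s
      length : forwards + backwards ≡ ℓ
      balance : forwards + side x ≡ backwards + side z
      shift : (index z + behind) % m ≡ (index x + ahead) % m

  empty : ∀ {x} → Summary x x 0
  empty = record
    { forwards = 0 ; backwards = 0 ; ahead = 0 ; behind = 0
    ; ahead-bound = z≤n ; behind-bound = z≤n
    ; length = refl ; balance = refl ; shift = refl }

  forward-step : ∀ {i j z ℓ} → UVAdj m Δ i j →
                 Summary (v j) z ℓ → Summary (u i) z (suc ℓ)
  forward-step {i} {j} {z} (k , k<Δ , j≡i+o) S = record
    { forwards = suc forwards ; backwards = backwards
    ; ahead = o + ahead ; behind = behind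
    ; ahead-bound = +-mono-≤ (offset≤maxOffset k<Δ) ahead-bound
    ; behind-bound = behind-bound
    ; length = cong suc length
    ; balance = trans (+-identityʳ (suc forwards)) (trans (+-comm 1 forwards) balance)
    ; shift = begin
        (index z + behind) % m          ≡⟨ shift ⟩
        (toℕ j + ahead) % m             ≡⟨ cong (λ t → (t + ahead) % m) j≡i+o ⟩
        ((toℕ i + o) % m + ahead) % m   ≡⟨ %-absorbˡ (toℕ i + o) ahead ⟩
        (toℕ i + o + ahead) % m         ≡⟨ cong (_% m) (+-assoc (toℕ i) o ahead) ⟩
        (toℕ i + (o + ahead)) % m       ∎ }
    where
    open Summary S
    open ≡-Reasoning
    o : ℕ
    o = 2 ^ k ∸ 1

  backward-step : ∀ {i j z ℓ} → UVAdj m Δ i j →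
                  Summary (u i) z ℓ → Summary (v j) z (suc ℓ)
  backward-step {i} {j} {z} (k , k<Δ , j≡i+o) S = record
    { forwards = forwards ; backwards = suc backwards
    ; ahead = ahead ; behind = behind + o
    ; ahead-bound = ahead-bound
    ; behind-bound = subst (behind + o ≤_) (+-comm (backwards * s) s)
        (+-mono-≤ behind-bound (offset≤maxOffset k<Δ))
    ; length = trans (+-suc forwards backwards) (cong suc length)
    ; balance = trans (+-comm forwards 1) (cong suc (trans (sym (+-identityʳ forwards)) balance))
    ; shift = begin
        (index z + (behind + o)) % m    ≡⟨ cong (_% m) (+-assoc (index z) behind o) ⟨
        (index z + behind + o) % m      ≡⟨ %-cong-+ʳ (index z + behind) (toℕ i + ahead) o shift ⟩
        (toℕ i + ahead + o) % m         ≡⟨ cong (_% m) (trans (+-assoc (toℕ i) ahead o)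
                                              (trans (cong (toℕ i +_) (+-comm ahead o))
                                                     (sym (+-assoc (toℕ i) o ahead)))) ⟩
        (toℕ i + o + ahead) % m         ≡⟨ %-absorbˡ (toℕ i + o) ahead ⟨
        ((toℕ i + o) % m + ahead) % m   ≡⟨ cong (λ t → (t + ahead) % m) j≡i+o ⟨
        (toℕ j + ahead) % m             ∎ }
    where
    open Summary S
    open ≡-Reasoning
    o : ℕ
    o = 2 ^ k ∸ 1

  summarise : ∀ {x z ℓ} → Walk m Δ x z ℓ → Summary x z ℓ
  summarise [] = empty
  summarise {false , _} (_∷_ {y = true , _} e w) = forward-step e (summarise w)
  summarise {true , _} (_∷_ {y = false , _} e w) = backward-step e (summarise w)
  summarise {false , _} (_∷_ {y = false , _} () w)
  summarise {true , _} (_∷_ {y = true , _} () w)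

  balanced : ∀ {i i′ ℓ} (S : Summary (u i) (u i′) ℓ) →
             Summary.forwards S ≡ Summary.backwards S
  balanced S = trans (sym (+-identityʳ forwards)) (trans balance (+-identityʳ backwards))
    where open Summary S

≤quarter⇒double≤half : ∀ {i m} → i ≤ (2 * m) / 4 → 2 * i ≤ m
≤quarter⇒double≤half {i} {m} i≤ = *-cancelˡ-≤ 2 (begin
  2 * (2 * i)       ≡⟨ trans (sym (*-assoc 2 2 i)) (*-comm 4 i) ⟩
  i * 4             ≤⟨ *-monoˡ-≤ 4 i≤ ⟩
  (2 * m) / 4 * 4   ≤⟨ m/n*n≤m (2 * m) 4 ⟩
  2 * m             ∎)
  where open ≤-Reasoning

offset-below : ∀ {X b k s i} → X ≤ b * s → b < k → (k ∸ 1) * s < i → X < i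
offset-below {s = s} X≤bs b<k ks<i =
  ≤-<-trans (≤-trans X≤bs (*-monoˡ-≤ s (<⇒≤pred b<k))) ks<i

-- Otherwise it has fewer than k steps in each
-- direction, so both total offsets are below i, contradicting 'no-wraparound'.
return-walk-long : ∀ {h Δ ℓ} (k : ℕ) (i : Fin (suc h)) →
                   (k ∸ 1) * maxOffset Δ < toℕ i → 2 * toℕ i ≤ suc h →
                   Summary (suc h) Δ (u zero) (u i) ℓ → 2 * k ≤ ℓ
return-walk-long {h} {Δ} {ℓ} k i ks<i 2i≤m S with k ≤? forwards
  where open Summary S
... | yes k≤a = begin
  2 * k                     ≤⟨ *-monoʳ-≤ 2 k≤a ⟩
  forwards + (forwards + 0) ≡⟨ cong (forwards +_) (trans (+-identityʳ forwards) a≡c) ⟩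
  forwards + backwards      ≡⟨ length ⟩
  ℓ                         ∎
  where
  open Summary S
  open ≤-Reasoning
  a≡c : forwards ≡ backwards
  a≡c = balanced (suc h) Δ S
... | no k≰a = contradiction shift (no-wraparound ahead<i behind<i 2i≤m)
  where
  open Summary S
  a<k : forwards < k
  a<k = ≰⇒> k≰a
  ahead<i : ahead < toℕ i
  ahead<i = offset-below ahead-bound a<k ks<i
  behind<i : behind < toℕ i
  behind<i = offset-below behind-bound (subst (_< k) (balanced (suc h) Δ S) a<k) ks<i

mainTheorem5 : (h Δ k : ℕ) →
    1 ≤ Δ → Δ ≤ ⌊log₂ (2 * suc h) ⌋ → 1 ≤ k →
    (i : Fin (suc h)) →
    (k ∸ 1) * (2 ^ (Δ ∸ 1) ∸ 1) < toℕ i → toℕ i ≤ (2 * suc h) / 4 →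
    DistGE (suc h) Δ (u zero) (u i) (2 * k)
mainTheorem5 h Δ k _ _ _ i ks<i i≤quarter ℓ w =
  return-walk-long k i ks<i (≤quarter⇒double≤half i≤quarter) (summarise (suc h) Δ w)
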